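{- Let $k,s$ be integers with $2\le k\le s-2$. For every $K_s$-saturated graph $G$ on $n$ vertices with the minimum number of copies of $M_k$ (among all $n$-vertex $K_s$-saturated graphs), the number of independent sets of size $k$ in $G$ is $(1-o(1))\binom{n}{k}$ as $n\to\infty$.
   Context: A graph $G$ is $K_s$-saturated if $G$ contains no copy of the complete graph $K_s$, but adding any missing edge creates a copy of $K_s$. $M_k$ is a matching with $k$ edges; a copy of $M_k$ in $G$ is a subgraph of $G$ isomorphic to $M_k$. -}

module Defs where

open import Data.Bool using (Bool; true; false; T; not; _∧_; _∨_)
open import Data.Nat using (ℕ; zero; suc; _∸_; _*_; _≤_)
open import Data.Nat.Combinatorics using (_C_)
open import Data.Fin using (Fin; _≟_)
open import Data.List using (List; []; _∷_; [_]; map; _++_; allFin; filterᵇ; length)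
open import Data.Bool.ListAction using (all; any)
open import Data.List.Membership.Propositional using (_∈_)
open import Data.Product using (Σ; _×_; ∃)
open import Data.Empty using (⊥)
open import Relation.Nullary using (¬_)
open import Relation.Nullary.Decidable using (⌊_⌋)
open import Relation.Binary.PropositionalEquality using (_≡_)

-- k-element sublists (= k-subsets, listed in increasing order when xs is)
choose : {A : Set} → ℕ → List A → List (List A)
choose zero    _        = [ [] ]
choose (suc k) []       = []
choose (suc k) (x ∷ xs) = map (x ∷_) (choose k xs) ++ choose (suc k) xs

allPairsB : {A : Set} → (A → A → Bool) → List A → Bool
allPairsB p []       = true
allPairsB p (x ∷ xs) = all (p x) xs ∧ allPairsB p xs

record Graph (n : ℕ) : Set where
  field
    adj    : Fin n → Fin n → Bool
    sym    : ∀ i j → adj i j ≡ adj j i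
    irrefl : ∀ i → adj i i ≡ false
open Graph public

_==_ : {n : ℕ} → Fin n → Fin n → Bool
i == j = ⌊ i ≟ j ⌋

addEdge : {n : ℕ} → (Fin n → Fin n → Bool) → Fin n → Fin n → (Fin n → Fin n → Bool)
addEdge a i j x y = a x y ∨ ((x == i) ∧ (y == j)) ∨ ((x == j) ∧ (y == i))

isClique : {n : ℕ} → (Fin n → Fin n → Bool) → List (Fin n) → Bool
isClique a S = allPairsB a S

isIndependent : {n : ℕ} → (Fin n → Fin n → Bool) → List (Fin n) → Bool
isIndependent a S = allPairsB (λ x y → not (a x y)) S

KFree : (s : ℕ) {n : ℕ} → Graph n → Set
KFree s {n} G = ∀ S → S ∈ choose s (allFin n) → ¬ T (isClique (adj G) S)

Saturated : (s : ℕ) {n : ℕ} → Graph n → Set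
Saturated s {n} G =
  KFree s G ×
  (∀ i j → ¬ (i ≡ j) → adj G i j ≡ false →
     Σ (List (Fin n)) λ S → S ∈ choose s (allFin n) × T (isClique (addEdge (adj G) i j) S))

-- edges as 2-element vertex lists [i , j] with i < j
edges : {n : ℕ} → Graph n → List (List (Fin n))
edges {n} G = filterᵇ (isClique (adj G)) (choose 2 (allFin n))

disjointB : {n : ℕ} → List (Fin n) → List (Fin n) → Bool
disjointB e f = not (any (λ x → any (x ==_) f) e)

-- number of copies of M_k in G (sets of k pairwise vertex-disjoint edges)
numMatchings : (k : ℕ) {n : ℕ} → Graph n → ℕ
numMatchings k G = length (filterᵇ (allPairsB disjointB) (choose k (edges G)))

numIndep : (k : ℕ) {n : ℕ} → Graph n → ℕ
numIndep k {n} G = length (filterᵇ (isIndependent (adj G)) (choose k (allFin n)))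

MinSaturated : (s k : ℕ) {n : ℕ} → Graph n → Set
MinSaturated s k {n} G = Saturated s G × (∀ (H : Graph n) → Saturated s H → numMatchings k G ≤ numMatchings k H)

{-# OPTIONS --safe #-}
module Submission where

-- Write s = c + 2 and k = j + 2. The join of K_c with an independent set is K_s-saturated and has
-- at most c n edges, hence at most (c n)^k copies of M_k, so a minimiser G has no more. In G every
-- edge meets at most 2 n edges, so extending matchings greedily (sparseC) yields (c n + 1)^k copies
-- of M_k as soon as G has k (2 n + c n + 1) edges; thus G has O(n) edges. Every non-independent
-- k-set contains an edge, so there are at most |E(G)| n^(k-2) = O(n^(k-1)) of them, which is o(n C k).

open import Defs hiding (sym)
open import Data.Bool using (Bool; true; false; T; not; _∧_; _∨_)
open import Data.Bool.ListAction using (all; any)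
open import Data.Bool.Properties using (T-∧; T-∨; T-not-≡; ∨-comm; ∨-conicalˡ; ∨-conicalʳ; ∨-identityʳ; not-involutive)
open import Data.Empty using (⊥-elim)
open import Data.Fin using (Fin; zero; suc; toℕ)
import Data.Fin.Properties as Fin
open import Data.List using (List; []; _∷_; [_]; map; _++_; filterᵇ; length; allFin)
open import Data.List.Properties using (length-++; length-map; length-filter; filter-++; filter-none; length-tabulate; map-tabulate)
open import Data.List.Membership.Propositional using (_∈_)
open import Data.List.Membership.Propositional.Properties using (∈-filter⁻; ∈-map⁺; ∈-map⁻; ∈-++⁺ˡ; ∈-++⁺ʳ; ∈-++⁻)
open import Data.List.Relation.Unary.All as All using (All; []; _∷_)
open import Data.List.Relation.Unary.All.Properties using (all⁺; all⁻; all-filter)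
open import Data.List.Relation.Unary.AllPairs using (AllPairs; []; _∷_)
import Data.List.Relation.Unary.AllPairs.Properties as AllPairs
open import Data.List.Relation.Unary.Any using (here)
open import Data.List.Relation.Binary.Sublist.Propositional using (_⊆_; _∷_; _∷ʳ_; minimum; ⊆-refl)
open import Data.List.Relation.Binary.Sublist.Propositional.Properties using (filter⁺; filter-⊆; length-mono-≤; All-resp-⊆)
open import Data.Nat
open import Data.Nat.Properties
import Algebra.Properties.CommutativeSemigroup +-commutativeSemigroup as +-Semigroup
import Algebra.Properties.CommutativeSemigroup *-commutativeSemigroup as *-Semigroup
open import Data.Nat.DivMod using (_/_; _%_; m≡m%n+[m/n]*n; m%n<n; m*n/n≡m; m/n*n≤m; /-monoˡ-≤)
open import Data.Nat.Combinatorics using (_C_; nCk+nC[k+1]≡[n+1]C[k+1])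
open import Data.Product using (Σ; _×_; _,_; proj₁; proj₂)
open import Data.Sum as Sum using (_⊎_; inj₁; inj₂)
open import Data.Unit using (tt)
open import Function using (_∘_; id; Equivalence)
open import Relation.Binary.PropositionalEquality using (_≡_; _≢_; refl; sym; trans; cong; cong₂; subst; module ≡-Reasoning)
open import Relation.Nullary using (¬_; yes; no)
open import Relation.Nullary.Decidable using (T?; isYes≗does; dec-true; dec-false; toWitness)

-- Counting with Boolean predicates

count : {A : Set} → (A → Bool) → List A → ℕ
count p xs = length (filterᵇ p xs)

module _ {A : Set} where

  count-++ : (p : A → Bool) (xs ys : List A) → count p (xs ++ ys) ≡ count p xs + count p ys
  count-++ p xs ys = trans (cong length (filter-++ (T? ∘ p) xs ys)) (length-++ (filterᵇ p xs))

  count-map : {B : Set} (p : B → Bool) (f : A → B) (xs : List A) → count p (map f xs) ≡ count (p ∘ f) xs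
  count-map p f [] = refl
  count-map p f (x ∷ xs) with p (f x)
  ... | true  = cong suc (count-map p f xs)
  ... | false = count-map p f xs

  count-cong : {p q : A → Bool} → (∀ x → p x ≡ q x) → (xs : List A) → count p xs ≡ count q xs
  count-cong p≗q []       = refl
  count-cong {p} {q} p≗q (x ∷ xs) with p x | q x | p≗q x
  ... | true  | true  | _ = cong suc (count-cong p≗q xs)
  ... | false | false | _ = count-cong p≗q xs

  count≤length : (p : A → Bool) (xs : List A) → count p xs ≤ length xs
  count≤length p = length-filter (T? ∘ p)

  count-none : {p : A → Bool} {xs : List A} → All (λ x → ¬ T (p x)) xs → count p xs ≡ 0
  count-none {p} h = cong length (filter-none (T? ∘ p) h)

  count-mono : {p q : A → Bool} {xs : List A} → All (λ x → T (p x) → T (q x)) xs → count p xs ≤ count q xs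
  count-mono [] = z≤n
  count-mono {p} {q} (_∷_ {x} p⇒q hs) with p x | q x
  ... | true  | true  = s≤s (count-mono hs)
  ... | true  | false = ⊥-elim (p⇒q tt)
  ... | false | true  = m≤n⇒m≤1+n (count-mono hs)
  ... | false | false = count-mono hs

  count-⊆ : (p : A → Bool) {xs ys : List A} → xs ⊆ ys → count p xs ≤ count p ys
  count-⊆ p xs⊆ys = length-mono-≤ (filter⁺ (T? ∘ p) (T? ∘ p) (λ { refl px → px }) xs⊆ys)

  count+count-not : (p : A → Bool) (xs : List A) → count p xs + count (not ∘ p) xs ≡ length xs
  count+count-not p [] = refl
  count+count-not p (x ∷ xs) with p x
  ... | true  = cong suc (count+count-not p xs)
  ... | false = trans (+-suc (count p xs) _) (cong suc (count+count-not p xs))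

  count-∨+count-∧ : (p q : A → Bool) (xs : List A) →
    count (λ x → p x ∨ q x) xs + count (λ x → p x ∧ q x) xs ≡ count p xs + count q xs
  count-∨+count-∧ p q [] = refl
  count-∨+count-∧ p q (x ∷ xs) with p x | q x
  ... | true  | true  = cong suc (trans (+-suc _ _) (trans (cong suc ih) (sym (+-suc _ _))))
    where ih = count-∨+count-∧ p q xs
  ... | true  | false = cong suc (count-∨+count-∧ p q xs)
  ... | false | true  = trans (cong suc (count-∨+count-∧ p q xs)) (sym (+-suc _ _))
  ... | false | false = count-∨+count-∧ p q xs

  count-∨≤ : (p q : A → Bool) (xs : List A) → count (λ x → p x ∨ q x) xs ≤ count p xs + count q xs
  count-∨≤ p q xs = subst (count (λ x → p x ∨ q x) xs ≤_) (count-∨+count-∧ p q xs) (m≤m+n _ _)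

  count-∨-disjoint : (p q : A → Bool) (xs : List A) → (∀ x → ¬ T (p x ∧ q x)) →
    count (λ x → p x ∨ q x) xs ≡ count p xs + count q xs
  count-∨-disjoint p q xs disjoint = begin
    count (λ x → p x ∨ q x) xs                                ≡⟨ +-identityʳ _ ⟨
    count (λ x → p x ∨ q x) xs + 0
      ≡⟨ cong (count (λ x → p x ∨ q x) xs +_) (count-none (All.universal disjoint xs)) ⟨
    count (λ x → p x ∨ q x) xs + count (λ x → p x ∧ q x) xs  ≡⟨ count-∨+count-∧ p q xs ⟩
    count p xs + count q xs                                   ∎
    where open ≡-Reasoning

-- k-subsets

module _ {A : Set} where

  length-choose-∷ : (k : ℕ) (x : A) (L : List A) →
    length (choose (suc k) (x ∷ L)) ≡ length (choose k L) + length (choose (suc k) L)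
  length-choose-∷ k x L =
    trans (length-++ (map (x ∷_) (choose k L))) (cong (_+ length (choose (suc k) L)) (length-map (x ∷_) (choose k L)))

  length-choose : (k : ℕ) (L : List A) → length (choose k L) ≡ length L C k
  length-choose zero    L       = refl
  length-choose (suc k) []      = refl
  length-choose (suc k) (x ∷ L) = begin
    length (choose (suc k) (x ∷ L))                  ≡⟨ length-choose-∷ k x L ⟩
    length (choose k L) + length (choose (suc k) L)  ≡⟨ cong₂ _+_ (length-choose k L) (length-choose (suc k) L) ⟩
    length L C k + length L C suc k                  ≡⟨ nCk+nC[k+1]≡[n+1]C[k+1] (length L) k ⟩
    suc (length L) C suc k                           ∎
    where open ≡-Reasoning

  count-choose-∷ : (P : List A → Bool) (k : ℕ) (y : A) (L : List A) →
    count P (choose (suc k) (y ∷ L)) ≡ count (P ∘ (y ∷_)) (choose k L) + count P (choose (suc k) L)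
  count-choose-∷ P k y L =
    trans (count-++ P (map (y ∷_) (choose k L)) (choose (suc k) L))
          (cong (_+ count P (choose (suc k) L)) (count-map P (y ∷_) (choose k L)))

  length-choose≤^ : (k : ℕ) (L : List A) → length (choose k L) ≤ length L ^ k
  length-choose≤^ zero    L       = ≤-refl
  length-choose≤^ (suc k) []      = z≤n
  length-choose≤^ (suc k) (x ∷ L) = begin
    length (choose (suc k) (x ∷ L))                  ≡⟨ length-choose-∷ k x L ⟩
    length (choose k L) + length (choose (suc k) L)  ≤⟨ +-mono-≤ (length-choose≤^ k L) (length-choose≤^ (suc k) L) ⟩
    length L ^ k + length L * length L ^ k           ≤⟨ *-monoʳ-≤ (suc (length L)) (^-monoˡ-≤ k (n≤1+n (length L))) ⟩
    suc (length L) ^ suc k                           ∎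
    where open ≤-Reasoning

  ∈-choose⁻ : (k : ℕ) (L : List A) {S : List A} → S ∈ choose k L → S ⊆ L × length S ≡ k
  ∈-choose⁻ zero    L       (here refl) = minimum L , refl
  ∈-choose⁻ (suc k) (x ∷ L) S∈ with ∈-++⁻ (map (x ∷_) (choose k L)) S∈
  ... | inj₂ S∈rest = let S⊆L , len = ∈-choose⁻ (suc k) L S∈rest in x ∷ʳ S⊆L , len
  ... | inj₁ S∈map with ∈-map⁻ (x ∷_) S∈map
  ...   | S , S∈ , refl = let S⊆L , len = ∈-choose⁻ k L S∈ in refl ∷ S⊆L , cong suc len

  ∈-choose-∷⁺ : (k : ℕ) (x : A) (L : List A) {S : List A} → S ∈ choose k L → S ∈ choose k (x ∷ L)
  ∈-choose-∷⁺ zero    x L S∈ = S∈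
  ∈-choose-∷⁺ (suc k) x L S∈ = ∈-++⁺ʳ (map (x ∷_) (choose k L)) S∈

  filterᵇ∈choose : (p : A → Bool) (L : List A) → filterᵇ p L ∈ choose (count p L) L
  filterᵇ∈choose p []      = here refl
  filterᵇ∈choose p (x ∷ L) with p x
  ... | true  = ∈-++⁺ˡ (∈-map⁺ (x ∷_) (filterᵇ∈choose p L))
  ... | false = ∈-choose-∷⁺ (count p L) x L (filterᵇ∈choose p L)

c*b^k+c*b^[1+k]≤c*[1+b]^[1+k] : ∀ c b k → c * b ^ k + c * b ^ suc k ≤ c * suc b ^ suc k
c*b^k+c*b^[1+k]≤c*[1+b]^[1+k] c b k = begin
  c * b ^ k + c * (b * b ^ k) ≡⟨ *-distribˡ-+ c (b ^ k) (b * b ^ k) ⟨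
  c * (suc b * b ^ k)         ≤⟨ *-monoʳ-≤ c (*-monoʳ-≤ (suc b) (^-monoˡ-≤ k (n≤1+n b))) ⟩
  c * suc b ^ suc k           ∎
  where open ≤-Reasoning

module _ {A : Set} where

  count-choose-filterᵇ : (q : A → Bool) (P : List A → Bool) (k : ℕ) (L : List A) →
    count P (choose k (filterᵇ q L)) ≡ count (λ S → all q S ∧ P S) (choose k L)
  count-choose-filterᵇ q P zero    L       with P []
  ... | true  = refl
  ... | false = refl
  count-choose-filterᵇ q P (suc k) []      = refl
  count-choose-filterᵇ q P (suc k) (y ∷ L) with q y in qy
  ... | true  = begin
    count P (choose (suc k) (y ∷ Lq))
      ≡⟨ count-choose-∷ P k y Lq ⟩
    count (P ∘ (y ∷_)) (choose k Lq) + count P (choose (suc k) Lq)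
      ≡⟨ cong₂ _+_ (count-choose-filterᵇ q (P ∘ (y ∷_)) k L) (count-choose-filterᵇ q P (suc k) L) ⟩
    count (λ S → all q S ∧ P (y ∷ S)) (choose k L) + count Q (choose (suc k) L)
      ≡⟨ cong (_+ count Q (choose (suc k) L)) (count-cong (λ S → cong (λ b → (b ∧ all q S) ∧ P (y ∷ S)) qy) (choose k L)) ⟨
    count (Q ∘ (y ∷_)) (choose k L) + count Q (choose (suc k) L)
      ≡⟨ count-choose-∷ Q k y L ⟨
    count Q (choose (suc k) (y ∷ L)) ∎
    where
      open ≡-Reasoning
      Lq = filterᵇ q L
      Q = λ S → all q S ∧ P S
  ... | false = begin
    count P (choose (suc k) (filterᵇ q L))
      ≡⟨ count-choose-filterᵇ q P (suc k) L ⟩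
    count Q (choose (suc k) L)
      ≡⟨ cong (_+ count Q (choose (suc k) L)) (count-none (All.universal noneWithY (choose k L))) ⟨
    count (Q ∘ (y ∷_)) (choose k L) + count Q (choose (suc k) L)
      ≡⟨ count-choose-∷ Q k y L ⟨
    count Q (choose (suc k) (y ∷ L)) ∎
    where
      open ≡-Reasoning
      Q = λ S → all q S ∧ P S
      noneWithY : ∀ S → ¬ T (Q (y ∷ S))
      noneWithY S rewrite qy = λ ()

  count-any-choose≤ : (p : A → Bool) (k : ℕ) (L : List A) →
    count (any p) (choose (suc k) L) ≤ count p L * length L ^ k
  count-any-choose≤ p k []      = z≤n
  count-any-choose≤ p k (y ∷ L) with p y in py
  ... | true  = begin
    count (any p) (choose (suc k) (y ∷ L))
      ≡⟨ count-choose-∷ (any p) k y L ⟩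
    count (any p ∘ (y ∷_)) (choose k L) + count (any p) (choose (suc k) L)
      ≤⟨ +-mono-≤ (≤-trans (count≤length _ (choose k L)) (length-choose≤^ k L)) (count-any-choose≤ p k L) ⟩
    b ^ k + c * b ^ k
      ≤⟨ *-monoʳ-≤ (suc c) (^-monoˡ-≤ k (n≤1+n b)) ⟩
    suc c * suc b ^ k ∎
    where
      open ≤-Reasoning
      b = length L
      c = count p L
  ... | false = begin
    count (any p) (choose (suc k) (y ∷ L))
      ≡⟨ count-choose-∷ (any p) k y L ⟩
    count (any p ∘ (y ∷_)) (choose k L) + count (any p) (choose (suc k) L)
      ≡⟨ cong (_+ count (any p) (choose (suc k) L)) (count-cong (λ S → cong (_∨ any p S) py) (choose k L)) ⟩
    count (any p) (choose k L) + count (any p) (choose (suc k) L)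
      ≤⟨ +-monoʳ-≤ (count (any p) (choose k L)) (count-any-choose≤ p k L) ⟩
    count (any p) (choose k L) + c * b ^ k
      ≤⟨ smaller k ⟩
    c * suc b ^ k ∎
    where
      open ≤-Reasoning
      b = length L
      c = count p L
      smaller : ∀ j → count (any p) (choose j L) + c * b ^ j ≤ c * suc b ^ j
      smaller zero    = ≤-refl
      smaller (suc j) = ≤-trans (+-monoˡ-≤ (c * b ^ suc j) (count-any-choose≤ p j L)) (c*b^k+c*b^[1+k]≤c*[1+b]^[1+k] c b j)

module _ {A : Set} (r : A → A → Bool) where

  allPairsB-intro : {R : A → A → Set} {Q : A → Set} {xs : List A} →
    (∀ {x y} → R x y → Q x → Q y → T (r x y)) → AllPairs R xs → All Q xs → T (allPairsB r xs)
  allPairsB-intro r-intro []         []         = tt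
  allPairsB-intro r-intro (Rx ∷ Rxs) (qx ∷ qxs) = Equivalence.from T-∧
    ( all⁻ (r _) (All.zipWith (λ (Rxy , qy) → r-intro Rxy qx qy) (Rx , qxs))
    , allPairsB-intro r-intro Rxs qxs )

  T-allPairsB-pair : (a b : A) → T (allPairsB r (a ∷ b ∷ [])) → T (r a b)
  T-allPairsB-pair a b with r a b
  ... | true  = λ _ → tt
  ... | false = λ ()

  count-allPairsB-choose-∷ : (k : ℕ) (x : A) (L : List A) →
    count (allPairsB r) (choose (suc k) (x ∷ L)) ≡
    count (allPairsB r) (choose k (filterᵇ (r x) L)) + count (allPairsB r) (choose (suc k) L)
  count-allPairsB-choose-∷ k x L =
    trans (count-choose-∷ (allPairsB r) k x L)
          (cong (_+ count (allPairsB r) (choose (suc k) L)) (sym (count-choose-filterᵇ (r x) (allPairsB r) k L)))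

  count-allPairsB-choose-1 : (L : List A) → count (allPairsB r) (choose 1 L) ≡ length L
  count-allPairsB-choose-1 []      = refl
  count-allPairsB-choose-1 (x ∷ L) = cong suc (count-allPairsB-choose-1 L)

  count-allPairsB-choose-2-∷ : (x : A) (L : List A) →
    count (allPairsB r) (choose 2 (x ∷ L)) ≡ count (r x) L + count (allPairsB r) (choose 2 L)
  count-allPairsB-choose-2-∷ x L =
    trans (count-allPairsB-choose-∷ 1 x L)
          (cong (_+ count (allPairsB r) (choose 2 L)) (count-allPairsB-choose-1 (filterᵇ (r x) L)))

  nonIndependent : List A → Bool
  nonIndependent S = not (allPairsB (λ x y → not (r x y)) S)

  count-nonIndependent-∷≤ : (y : A) (Ss : List (List A)) →
    count (nonIndependent ∘ (y ∷_)) Ss ≤ count (any (r y)) Ss + count nonIndependent Ss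
  count-nonIndependent-∷≤ y Ss =
    ≤-trans (count-mono (All.universal nonIndependent-∷ Ss)) (count-∨≤ (any (r y)) nonIndependent Ss)
    where
      not-all-not : ∀ S → not (all (not ∘ r y) S ∧ true) ≡ any (r y) S
      not-all-not []      = refl
      not-all-not (z ∷ S) with r y z
      ... | true  = refl
      ... | false = not-all-not S
      nonIndependent-∷ : ∀ S → T (nonIndependent (y ∷ S)) → T (any (r y) S ∨ nonIndependent S)
      nonIndependent-∷ S h with allPairsB (λ x y → not (r x y)) S
      ... | false = Equivalence.from T-∨ (inj₂ tt)
      ... | true  = Equivalence.from T-∨ (inj₁ (subst T (not-all-not S) h))

  count-nonIndependent-choose-1 : (L : List A) → count nonIndependent (choose 1 L) ≡ 0
  count-nonIndependent-choose-1 []      = refl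
  count-nonIndependent-choose-1 (x ∷ L) = count-nonIndependent-choose-1 L

  count-nonIndependent-choose≤ : (k : ℕ) (L : List A) →
    count nonIndependent (choose (2 + k) L) ≤ count (allPairsB r) (choose 2 L) * length L ^ k
  count-nonIndependent-choose≤ k []      = z≤n
  count-nonIndependent-choose≤ k (y ∷ L) = begin
    count nonIndependent (choose (2 + k) (y ∷ L))
      ≡⟨ count-choose-∷ nonIndependent (suc k) y L ⟩
    count (nonIndependent ∘ (y ∷_)) (choose (suc k) L) + count nonIndependent (choose (2 + k) L)
      ≤⟨ +-monoˡ-≤ _ (count-nonIndependent-∷≤ y (choose (suc k) L)) ⟩
    (count (any (r y)) (choose (suc k) L) + count nonIndependent (choose (suc k) L)) + count nonIndependent (choose (2 + k) L)
      ≡⟨ +-assoc (count (any (r y)) (choose (suc k) L)) _ _ ⟩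
    count (any (r y)) (choose (suc k) L) + (count nonIndependent (choose (suc k) L) + count nonIndependent (choose (2 + k) L))
      ≤⟨ +-mono-≤ (count-any-choose≤ (r y) k L)
                  (+-monoʳ-≤ (count nonIndependent (choose (suc k) L)) (count-nonIndependent-choose≤ k L)) ⟩
    d * b ^ k + (count nonIndependent (choose (suc k) L) + e * b ^ k)
      ≤⟨ +-mono-≤ (*-monoʳ-≤ d (^-monoˡ-≤ k (n≤1+n b))) (smaller k) ⟩
    d * suc b ^ k + e * suc b ^ k
      ≡⟨ *-distribʳ-+ (suc b ^ k) d e ⟨
    (d + e) * suc b ^ k
      ≡⟨ cong (_* suc b ^ k) (count-allPairsB-choose-2-∷ y L) ⟨
    count (allPairsB r) (choose 2 (y ∷ L)) * suc b ^ k ∎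
    where
      open ≤-Reasoning
      b = length L
      d = count (r y) L
      e = count (allPairsB r) (choose 2 L)
      smaller : ∀ j → count nonIndependent (choose (suc j) L) + e * b ^ j ≤ e * suc b ^ j
      smaller zero    = ≤-reflexive (cong (_+ e * 1) (count-nonIndependent-choose-1 L))
      smaller (suc j) = ≤-trans (+-monoˡ-≤ (e * b ^ suc j) (count-nonIndependent-choose≤ j L)) (c*b^k+c*b^[1+k]≤c*[1+b]^[1+k] e b j)

-- Pascal's rule in which choosing an element also discards D others; sparseC 0 e k = e C k.
sparseC : ℕ → ℕ → ℕ → ℕ
sparseC D e       zero    = 1
sparseC D zero    (suc k) = 0
sparseC D (suc e) (suc k) = sparseC D (e ∸ D) k + sparseC D e (suc k)

sparseC-mono-≤ : ∀ D k {e e′} → e ≤ e′ → sparseC D e k ≤ sparseC D e′ k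
sparseC-mono-≤ D k {e′ = zero}   z≤n = ≤-refl
sparseC-mono-≤ D k {e′ = suc e′} e≤1+e′ with m≤n⇒m<n∨m≡n e≤1+e′
... | inj₂ refl        = ≤-refl
... | inj₁ (s≤s e≤e′) = ≤-trans (sparseC-mono-≤ D k e≤e′) (sparseC≤sparseC[1+e] k e′)
  where
    sparseC≤sparseC[1+e] : ∀ k e → sparseC D e k ≤ sparseC D (suc e) k
    sparseC≤sparseC[1+e] zero    e = ≤-refl
    sparseC≤sparseC[1+e] (suc k) e = m≤n+m (sparseC D e (suc k)) (sparseC D (e ∸ D) k)

m*sparseC≤sparseC : ∀ D k e m → m * sparseC D (e ∸ D) k ≤ sparseC D (e + m) (suc k)
m*sparseC≤sparseC D k e zero    = z≤n
m*sparseC≤sparseC D k e (suc m) rewrite +-suc e m =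
  +-mono-≤ (sparseC-mono-≤ D k (∸-monoˡ-≤ D (m≤m+n e m))) (m*sparseC≤sparseC D k e m)

^≤sparseC : ∀ D k t → t ^ k ≤ sparseC D (k * (D + t)) k
^≤sparseC D zero    t = ≤-refl
^≤sparseC D (suc k) t = begin
  t * t ^ k                      ≤⟨ *-monoʳ-≤ t (^≤sparseC D k t) ⟩
  t * sparseC D X k              ≡⟨ cong (λ e → t * sparseC D e k) (m+n∸m≡n D X) ⟨
  t * sparseC D (D + X ∸ D) k    ≤⟨ m*sparseC≤sparseC D k (D + X) t ⟩
  sparseC D (D + X + t) (suc k)  ≡⟨ cong (λ e → sparseC D e (suc k)) (+-Semigroup.xy∙z≈xz∙y D X t) ⟩
  sparseC D (suc k * (D + t)) (suc k) ∎
  where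
    open ≤-Reasoning
    X = k * (D + t)

C≡sparseC0 : ∀ e k → e C k ≡ sparseC 0 e k
C≡sparseC0 e       zero    = refl
C≡sparseC0 zero    (suc k) = refl
C≡sparseC0 (suc e) (suc k) =
  trans (sym (nCk+nC[k+1]≡[n+1]C[k+1] e k)) (cong₂ _+_ (C≡sparseC0 e k) (C≡sparseC0 e (suc k)))

^≤C : ∀ k t → t ^ k ≤ (k * t) C k
^≤C k t = subst (t ^ k ≤_) (sym (C≡sparseC0 (k * t) k)) (^≤sparseC 0 k t)

C-monoˡ-≤ : ∀ k {e e′} → e ≤ e′ → e C k ≤ e′ C k
C-monoˡ-≤ k {e} {e′} e≤e′ rewrite C≡sparseC0 e k | C≡sparseC0 e′ k = sparseC-mono-≤ 0 k e≤e′

module _ {A : Set} (r : A → A → Bool) (D : ℕ) where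

  ConflictsAtMost : List A → Set
  ConflictsAtMost L = All (λ x → count (not ∘ r x) L ≤ D) L

  conflictsAtMost-⊆ : {L′ L : List A} → L′ ⊆ L → ConflictsAtMost L → ConflictsAtMost L′
  conflictsAtMost-⊆ L′⊆L bounded = All.map (≤-trans (count-⊆ _ L′⊆L)) (All-resp-⊆ L′⊆L bounded)

  sparseC≤count-allPairsB-choose : (k : ℕ) (L : List A) → ConflictsAtMost L →
    sparseC D (length L) k ≤ count (allPairsB r) (choose k L)
  sparseC≤count-allPairsB-choose zero    L       bounded = ≤-refl
  sparseC≤count-allPairsB-choose (suc k) []      bounded = z≤n
  sparseC≤count-allPairsB-choose (suc k) (f ∷ L) bounded@(f-bounded ∷ _) = begin
    sparseC D (length L ∸ D) k + sparseC D (length L) (suc k)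
      ≤⟨ +-mono-≤ (≤-trans (sparseC-mono-≤ D k survivors)
                           (sparseC≤count-allPairsB-choose k Lf (conflictsAtMost-⊆ (f ∷ʳ filter-⊆ (T? ∘ r f) L) bounded)))
                  (sparseC≤count-allPairsB-choose (suc k) L (conflictsAtMost-⊆ (f ∷ʳ ⊆-refl) bounded)) ⟩
    count (allPairsB r) (choose k Lf) + count (allPairsB r) (choose (suc k) L)
      ≡⟨ count-allPairsB-choose-∷ r k f L ⟨
    count (allPairsB r) (choose (suc k) (f ∷ L)) ∎
    where
      open ≤-Reasoning
      Lf = filterᵇ (r f) L
      survivors : length L ∸ D ≤ length Lf
      survivors = begin
        length L ∸ D                        ≤⟨ ∸-monoʳ-≤ (length L) (≤-trans (count-⊆ (not ∘ r f) (f ∷ʳ ⊆-refl)) f-bounded) ⟩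
        length L ∸ conflicts                ≡⟨ cong (_∸ conflicts) (count+count-not (r f) L) ⟨
        count (r f) L + conflicts ∸ conflicts ≡⟨ m+n∸n≡m (count (r f) L) conflicts ⟩
        length Lf                           ∎
        where conflicts = count (not ∘ r f) L

-- Graphs on Fin n

length-allFin : ∀ n → length (allFin n) ≡ n
length-allFin n = length-tabulate id

count-allFin-suc : ∀ {n} (p : Fin (suc n) → Bool) → count p (allFin (suc n)) ≡ count p [ zero ] + count (p ∘ suc) (allFin n)
count-allFin-suc {n} p = begin
  count p (allFin (suc n))                           ≡⟨ cong (λ xs → count p (zero ∷ xs)) (map-tabulate id suc) ⟨
  count p ([ zero ] ++ map suc (allFin n))           ≡⟨ count-++ p [ zero ] (map suc (allFin n)) ⟩
  count p [ zero ] + count p (map suc (allFin n))    ≡⟨ cong (count p [ zero ] +_) (count-map p suc (allFin n)) ⟩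
  count p [ zero ] + count (p ∘ suc) (allFin n)      ∎
  where open ≡-Reasoning

module _ {n : ℕ} where

  ==-true : {x y : Fin n} → x ≡ y → (x == y) ≡ true
  ==-true {x} {y} x≡y = trans (isYes≗does (x Fin.≟ y)) (dec-true (x Fin.≟ y) x≡y)

  ==-false : {x y : Fin n} → x ≢ y → (x == y) ≡ false
  ==-false {x} {y} x≢y = trans (isYes≗does (x Fin.≟ y)) (dec-false (x Fin.≟ y) x≢y)

  ==-sym : (x y : Fin n) → (x == y) ≡ (y == x)
  ==-sym x y with x Fin.≟ y
  ... | yes x≡y = sym (==-true (sym x≡y))
  ... | no  x≢y = sym (==-false (x≢y ∘ sym))

==-suc : ∀ {n} (x y : Fin n) → (suc x == suc y) ≡ (x == y)
==-suc x y = trans (isYes≗does (suc x Fin.≟ suc y)) (sym (isYes≗does (x Fin.≟ y)))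

count-==-allFin : ∀ {n} (i : Fin n) → count (_== i) (allFin n) ≡ 1
count-==-allFin {suc n} zero    =
  trans (count-allFin-suc {n} (_== zero)) (cong suc (count-none {p = λ x → suc x == zero} (All.universal (λ _ ()) (allFin n))))
count-==-allFin {suc n} (suc i) = begin
  count (_== suc i) (allFin (suc n))                  ≡⟨ count-allFin-suc {n} (_== suc i) ⟩
  count (λ x → suc x == suc i) (allFin n)             ≡⟨ count-cong (λ x → ==-suc x i) (allFin n) ⟩
  count (_== i) (allFin n)                            ≡⟨ count-==-allFin i ⟩
  1                                                   ∎
  where open ≡-Reasoning

module _ {n : ℕ} (a : Fin n → Fin n → Bool) (i j : Fin n) {x y : Fin n} where

  addEdge-keeps : T (a x y) → T (addEdge a i j x y)
  addEdge-keeps = Equivalence.from (T-∨ {a x y} {(x == i) ∧ (y == j) ∨ (x == j) ∧ (y == i)}) ∘ inj₁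

  addEdge-adds : T (x == i) × T (y == j) ⊎ T (x == j) × T (y == i) → T (addEdge a i j x y)
  addEdge-adds = Equivalence.from (T-∨ {a x y} {(x == i) ∧ (y == j) ∨ (x == j) ∧ (y == i)}) ∘ inj₂
               ∘ Equivalence.from (T-∨ {(x == i) ∧ (y == j)} {(x == j) ∧ (y == i)})
               ∘ Sum.map (Equivalence.from T-∧) (Equivalence.from T-∧)

inCore : ℕ → {n : ℕ} → Fin n → Bool
inCore c x = toℕ x <ᵇ c

count-inCore-allFin : ∀ n c → count (inCore c) (allFin n) ≡ n ⊓ c
count-inCore-allFin zero    c       = refl
count-inCore-allFin (suc n) zero    = trans (count-allFin-suc {n} (inCore 0)) (count-none (All.universal (λ _ ()) (allFin n)))
count-inCore-allFin (suc n) (suc c) = trans (count-allFin-suc {n} (inCore (suc c))) (cong suc (count-inCore-allFin n c))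

-- K_c + complement of K_(n-c), the Erdős–Hajnal–Moon graph; its core is the vertices of index < c.
cliqueJoin : ℕ → (n : ℕ) → Graph n
cliqueJoin c n = record
  { adj    = λ x y → not (x == y) ∧ (inCore c x ∨ inCore c y)
  ; sym    = λ x y → cong₂ (λ b b′ → not b ∧ b′) (==-sym x y) (∨-comm (inCore c x) (inCore c y))
  ; irrefl = λ x → cong (λ b → not b ∧ (inCore c x ∨ inCore c x)) (==-true refl)
  }

module _ (c : ℕ) {n : ℕ} where

  private
    G = cliqueJoin c n

  cliqueJoin-adj : {x y : Fin n} → x ≢ y → T (inCore c x) ⊎ T (inCore c y) → T (adj G x y)
  cliqueJoin-adj {x} {y} x≢y core =
    Equivalence.from T-∧ (subst (T ∘ not) (sym (==-false x≢y)) tt , Equivalence.from (T-∨ {inCore c x} {inCore c y}) core)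

  cliqueJoin-nonCore : {x y : Fin n} → inCore c x ≡ false → T (adj G x y) → T (inCore c y)
  cliqueJoin-nonCore {x} {y} x∉core x~y =
    subst (λ b → T (b ∨ inCore c y)) x∉core (proj₂ (Equivalence.to (T-∧ {not (x == y)} {inCore c x ∨ inCore c y}) x~y))

  clique-count-nonCore≤1 : (S : List (Fin n)) → T (isClique (adj G) S) → count (not ∘ inCore c) S ≤ 1
  clique-count-nonCore≤1 []      _  = z≤n
  clique-count-nonCore≤1 (x ∷ S) cl with Equivalence.to T-∧ cl | inCore c x in x∈?core
  ... | _ , S-clique | true  = clique-count-nonCore≤1 S S-clique
  ... | x~S , _      | false = s≤s (≤-reflexive (count-none (All.map core⇒¬nonCore (all⁺ (adj G x) S x~S))))
    where
      core⇒¬nonCore : ∀ {y} → T (adj G x y) → ¬ T (not (inCore c y))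
      core⇒¬nonCore x~y y∉core = subst T (Equivalence.to T-not-≡ y∉core) (cliqueJoin-nonCore x∈?core x~y)

  cliqueJoin-KFree : KFree (2 + c) G
  cliqueJoin-KFree S S∈ S-clique = 1+n≰n (begin
    suc (suc c)                                         ≡⟨ |S|≡2+c ⟨
    length S                                            ≡⟨ count+count-not (inCore c) S ⟨
    count (inCore c) S + count (not ∘ inCore c) S       ≤⟨ +-mono-≤ core≤c (clique-count-nonCore≤1 S S-clique) ⟩
    c + 1                                               ≡⟨ +-comm c 1 ⟩
    suc c                                               ∎)
    where
      open ≤-Reasoning
      S⊆V = proj₁ (∈-choose⁻ (2 + c) (allFin n) S∈)
      |S|≡2+c = proj₂ (∈-choose⁻ (2 + c) (allFin n) S∈)
      core≤c : count (inCore c) S ≤ c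
      core≤c = ≤-trans (count-⊆ (inCore c) S⊆V) (≤-trans (≤-reflexive (count-inCore-allFin n c)) (m⊓n≤n n c))

  cliqueJoin-nonAdjacent : ∀ {i j} → i ≢ j → adj G i j ≡ false → inCore c i ≡ false × inCore c j ≡ false
  cliqueJoin-nonAdjacent {i} {j} i≢j i≁j =
    ∨-conicalˡ (inCore c i) (inCore c j) i∨j∉core , ∨-conicalʳ (inCore c i) (inCore c j) i∨j∉core
    where
      i∨j∉core : (inCore c i ∨ inCore c j) ≡ false
      i∨j∉core = trans (cong (λ b → not b ∧ (inCore c i ∨ inCore c j)) (sym (==-false i≢j))) i≁j

  module _ (i j : Fin n) where

    isIJ : Fin n → Bool
    isIJ x = (x == i) ∨ (x == j)

    inCoreIJ : Fin n → Bool
    inCoreIJ x = inCore c x ∨ isIJ x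

    count-inCoreIJ : i ≢ j → inCore c i ≡ false → inCore c j ≡ false → count inCoreIJ (allFin n) ≡ 2 + c
    count-inCoreIJ i≢j i∉core j∉core = begin
      count inCoreIJ (allFin n)                                      ≡⟨ count-∨-disjoint (inCore c) isIJ (allFin n) isIJ∉core ⟩
      count (inCore c) (allFin n) + count isIJ (allFin n)
        ≡⟨ cong₂ _+_ (count-inCore-allFin n c) (count-∨-disjoint (_== i) (_== j) (allFin n) i≠j) ⟩
      n ⊓ c + (count (_== i) (allFin n) + count (_== j) (allFin n))
        ≡⟨ cong₂ _+_ (m≥n⇒m⊓n≡n c≤n) (cong₂ _+_ (count-==-allFin i) (count-==-allFin j)) ⟩
      c + 2                                                          ≡⟨ +-comm c 2 ⟩
      2 + c                                                          ∎
      where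
        open ≡-Reasoning
        isIJ∉core : ∀ x → ¬ T (inCore c x ∧ isIJ x)
        isIJ∉core x core∧ij with Equivalence.to (T-∧ {inCore c x} {isIJ x}) core∧ij
        ... | x∈core , x∈ij with Equivalence.to (T-∨ {x == i} {x == j}) x∈ij
        ...   | inj₁ x=i = subst T i∉core (subst (T ∘ inCore c) (toWitness x=i) x∈core)
        ...   | inj₂ x=j = subst T j∉core (subst (T ∘ inCore c) (toWitness x=j) x∈core)
        i≠j : ∀ x → ¬ T ((x == i) ∧ (x == j))
        i≠j x x=i∧x=j = let x=i , x=j = Equivalence.to (T-∧ {x == i} {x == j}) x=i∧x=j
                        in i≢j (trans (sym (toWitness x=i)) (toWitness x=j))
        c≤n : c ≤ n
        c≤n = ≤-trans (≮⇒≥ (λ i<c → subst T i∉core (<⇒<ᵇ i<c))) (<⇒≤ (Fin.toℕ<n i))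

    inCoreIJ-addEdge : ∀ {x y} → x ≢ y → T (inCoreIJ x) → T (inCoreIJ y) → T (addEdge (adj G) i j x y)
    inCoreIJ-addEdge {x} {y} x≢y x∈ y∈
      with Equivalence.to (T-∨ {inCore c x} {isIJ x}) x∈ | Equivalence.to (T-∨ {inCore c y} {isIJ y}) y∈
    ... | inj₁ x∈core | _           = addEdge-keeps (adj G) i j (cliqueJoin-adj x≢y (inj₁ x∈core))
    ... | inj₂ _      | inj₁ y∈core = addEdge-keeps (adj G) i j (cliqueJoin-adj x≢y (inj₂ y∈core))
    ... | inj₂ x∈ij   | inj₂ y∈ij
      with Equivalence.to (T-∨ {x == i} {x == j}) x∈ij | Equivalence.to (T-∨ {y == i} {y == j}) y∈ij
    ...   | inj₁ x=i | inj₁ y=i = ⊥-elim (x≢y (trans (toWitness x=i) (sym (toWitness y=i))))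
    ...   | inj₁ x=i | inj₂ y=j = addEdge-adds (adj G) i j (inj₁ (x=i , y=j))
    ...   | inj₂ x=j | inj₁ y=i = addEdge-adds (adj G) i j (inj₂ (x=j , y=i))
    ...   | inj₂ x=j | inj₂ y=j = ⊥-elim (x≢y (trans (toWitness x=j) (sym (toWitness y=j))))

  cliqueJoin-addEdge-clique : ∀ i j → i ≢ j → adj G i j ≡ false →
    Σ (List (Fin n)) λ S → S ∈ choose (2 + c) (allFin n) × T (isClique (addEdge (adj G) i j) S)
  cliqueJoin-addEdge-clique i j i≢j i≁j = S , S∈ , S-clique
    where
      i∉core = proj₁ (cliqueJoin-nonAdjacent i≢j i≁j)
      j∉core = proj₂ (cliqueJoin-nonAdjacent i≢j i≁j)
      S = filterᵇ (inCoreIJ i j) (allFin n)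
      S∈ : S ∈ choose (2 + c) (allFin n)
      S∈ = subst (λ k → S ∈ choose k (allFin n)) (count-inCoreIJ i j i≢j i∉core j∉core) (filterᵇ∈choose (inCoreIJ i j) (allFin n))
      S-clique : T (isClique (addEdge (adj G) i j) S)
      S-clique = allPairsB-intro (addEdge (adj G) i j) (inCoreIJ-addEdge i j)
        (AllPairs.filter⁺ (T? ∘ inCoreIJ i j) (AllPairs.tabulate⁺ id)) (all-filter (T? ∘ inCoreIJ i j) (allFin n))

  cliqueJoin-saturated : Saturated (2 + c) G
  cliqueJoin-saturated = cliqueJoin-KFree , cliqueJoin-addEdge-clique

cliqueJoin-edges≤ : ∀ c n → length (edges (cliqueJoin c n)) ≤ c * n
cliqueJoin-edges≤ c n = begin
  count (isClique (adj J)) (choose 2 (allFin n))          ≤⟨ count-mono (All.tabulate edge⇒core) ⟩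
  count (any (inCore c)) (choose 2 (allFin n))            ≤⟨ count-any-choose≤ (inCore c) 1 (allFin n) ⟩
  count (inCore c) (allFin n) * length (allFin n) ^ 1     ≡⟨ cong₂ (λ a m → a * m ^ 1) (count-inCore-allFin n c) (length-allFin n) ⟩
  n ⊓ c * n ^ 1                                           ≤⟨ *-mono-≤ (m⊓n≤n n c) (≤-reflexive (^-identityʳ n)) ⟩
  c * n                                                   ∎
  where
    open ≤-Reasoning
    J = cliqueJoin c n
    edge⇒core : ∀ {S} → S ∈ choose 2 (allFin n) → T (isClique (adj J) S) → T (any (inCore c) S)
    edge⇒core S∈ with ∈-choose⁻ 2 (allFin n) S∈
    edge⇒core {a ∷ b ∷ []} S∈ | _ , refl = λ a~b →
      subst (λ z → T (inCore c a ∨ z)) (sym (∨-identityʳ (inCore c b)))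
        (proj₂ (Equivalence.to (T-∧ {not (a == b)} {inCore c a ∨ inCore c b}) (T-allPairsB-pair (adj J) a b a~b)))

count-meets-pairs≤ : ∀ {n} (f : List (Fin n)) → count (not ∘ disjointB f) (choose 2 (allFin n)) ≤ length f * n
count-meets-pairs≤ {n} f = begin
  count (not ∘ disjointB f) pairs                         ≡⟨ count-cong (λ h → not-involutive (any (λ x → any (x ==_) h) f)) pairs ⟩
  count (λ h → any (λ x → any (x ==_) h) f) pairs         ≤⟨ count-meets≤ f ⟩
  length f * n                                            ∎
  where
    open ≤-Reasoning
    pairs = choose 2 (allFin n)
    count-meets≤ : (f : List (Fin n)) → count (λ h → any (λ x → any (x ==_) h) f) pairs ≤ length f * n
    count-meets≤ []      = ≤-reflexive (count-none (All.universal (λ _ ()) pairs))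
    count-meets≤ (x ∷ f) = begin
      count (λ h → any (x ==_) h ∨ any (λ x → any (x ==_) h) f) pairs
        ≤⟨ count-∨≤ (any (x ==_)) (λ h → any (λ x → any (x ==_) h) f) pairs ⟩
      count (any (x ==_)) pairs + count (λ h → any (λ x → any (x ==_) h) f) pairs
        ≤⟨ +-mono-≤ (count-any-choose≤ (x ==_) 1 (allFin n)) (count-meets≤ f) ⟩
      count (x ==_) (allFin n) * length (allFin n) ^ 1 + length f * n
        ≡⟨ cong (λ m → count (x ==_) (allFin n) * m ^ 1 + length f * n) (length-allFin n) ⟩
      count (x ==_) (allFin n) * n ^ 1 + length f * n
        ≡⟨ cong (λ m → m * n ^ 1 + length f * n) (trans (count-cong (==-sym x) (allFin n)) (count-==-allFin x)) ⟩
      1 * n ^ 1 + length f * n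
        ≡⟨ cong (_+ length f * n) (trans (*-identityˡ (n ^ 1)) (^-identityʳ n)) ⟩
      suc (length f) * n ∎

edges-conflictsAtMost : ∀ {n} (G : Graph n) → ConflictsAtMost disjointB (2 * n) (edges G)
edges-conflictsAtMost {n} G = All.tabulate λ {f} f∈E → begin
  count (not ∘ disjointB f) (edges G)
    ≤⟨ count-⊆ (not ∘ disjointB f) (filter-⊆ (T? ∘ isClique (adj G)) (choose 2 (allFin n))) ⟩
  count (not ∘ disjointB f) (choose 2 (allFin n))         ≤⟨ count-meets-pairs≤ f ⟩
  length f * n                                            ≡⟨ cong (_* n) (|f|≡2 f∈E) ⟩
  2 * n                                                   ∎
  where
    open ≤-Reasoning
    |f|≡2 : ∀ {f} → f ∈ edges G → length f ≡ 2
    |f|≡2 f∈E = proj₂ (∈-choose⁻ 2 (allFin n) (proj₁ (∈-filter⁻ (T? ∘ isClique (adj G)) f∈E)))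

sparseC≤numMatchings : ∀ k {n} (G : Graph n) → sparseC (2 * n) (length (edges G)) k ≤ numMatchings k G
sparseC≤numMatchings k G = sparseC≤count-allPairsB-choose disjointB _ k (edges G) (edges-conflictsAtMost G)

numMatchings≤ : ∀ k {n} (G : Graph n) → numMatchings k G ≤ length (edges G) ^ k
numMatchings≤ k G = ≤-trans (count≤length (allPairsB disjointB) (choose k (edges G))) (length-choose≤^ k (edges G))

C∸numIndep≡ : ∀ k {n} (G : Graph n) → n C k ∸ numIndep k G ≡ count (nonIndependent (adj G)) (choose k (allFin n))
C∸numIndep≡ k {n} G = begin
  n C k ∸ I                                         ≡⟨ cong (λ m → m C k ∸ I) (length-allFin n) ⟨
  length (allFin n) C k ∸ I                         ≡⟨ cong (_∸ I) (length-choose k (allFin n)) ⟨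
  length (choose k (allFin n)) ∸ I                  ≡⟨ cong (_∸ I) (count+count-not (isIndependent (adj G)) (choose k (allFin n))) ⟨
  I + count (nonIndependent (adj G)) (choose k (allFin n)) ∸ I
                                                    ≡⟨ m+n∸m≡n I _ ⟩
  count (nonIndependent (adj G)) (choose k (allFin n)) ∎
  where
    open ≡-Reasoning
    I = numIndep k G

C∸numIndep≤ : ∀ j {n} (G : Graph n) → n C (2 + j) ∸ numIndep (2 + j) G ≤ length (edges G) * n ^ j
C∸numIndep≤ j {n} G = begin
  n C (2 + j) ∸ numIndep (2 + j) G                          ≡⟨ C∸numIndep≡ (2 + j) G ⟩
  count (nonIndependent (adj G)) (choose (2 + j) (allFin n)) ≤⟨ count-nonIndependent-choose≤ (adj G) j (allFin n) ⟩
  length (edges G) * length (allFin n) ^ j                   ≡⟨ cong (λ m → length (edges G) * m ^ j) (length-allFin n) ⟩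
  length (edges G) * n ^ j                                   ∎
  where open ≤-Reasoning

minSaturated-edges< : ∀ c j {n} (G : Graph n) → MinSaturated (2 + c) (suc j) G →
  length (edges G) < suc j * (2 * n + suc (c * n))
minSaturated-edges< c j {n} G (_ , minimal) = ≰⇒> λ many → <-irrefl refl (begin-strict
  t ^ k                                       ≤⟨ ^≤sparseC (2 * n) k t ⟩
  sparseC (2 * n) (k * (2 * n + t)) k         ≤⟨ sparseC-mono-≤ (2 * n) k many ⟩
  sparseC (2 * n) (length (edges G)) k        ≤⟨ sparseC≤numMatchings k G ⟩
  numMatchings k G                            ≤⟨ minimal (cliqueJoin c n) (cliqueJoin-saturated c) ⟩
  numMatchings k (cliqueJoin c n)             ≤⟨ numMatchings≤ k (cliqueJoin c n) ⟩
  length (edges (cliqueJoin c n)) ^ k         ≤⟨ ^-monoˡ-≤ k (cliqueJoin-edges≤ c n) ⟩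
  (c * n) ^ k                                 <⟨ ^-monoˡ-< k (n<1+n (c * n)) ⟩
  t ^ k                                       ∎)
  where
    open ≤-Reasoning
    k = suc j
    t = suc (c * n)

minSaturated-edges≤ : ∀ c j {n} (G : Graph n) → 1 ≤ n → MinSaturated (2 + c) (suc j) G →
  length (edges G) ≤ suc j * (3 + c) * n
minSaturated-edges≤ c j {n} G 1≤n G-min = begin
  length (edges G)                 ≤⟨ <⇒≤ (minSaturated-edges< c j G G-min) ⟩
  suc j * (2 * n + suc (c * n))    ≤⟨ *-monoʳ-≤ (suc j) (+-monoʳ-≤ (2 * n) (+-monoˡ-≤ (c * n) 1≤n)) ⟩
  suc j * (2 * n + (n + c * n))    ≡⟨ cong (suc j *_) (*-distribʳ-+ n 2 (suc c)) ⟨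
  suc j * ((3 + c) * n)            ≡⟨ *-assoc (suc j) (3 + c) n ⟨
  suc j * (3 + c) * n              ∎
  where open ≤-Reasoning

^-distribʳ-* : ∀ a b k → (a * b) ^ k ≡ a ^ k * b ^ k
^-distribʳ-* a b zero    = refl
^-distribʳ-* a b (suc k) = trans (cong (a * b *_) (^-distribʳ-* a b k)) (*-Semigroup.interchange a b (a ^ k) (b ^ k))

-- With t = ⌊n / (k + 1)⌋ we have n ≤ 2 (k + 1) t, and t^(k+1) ≤ ((k + 1) t) C (k + 1) ≤ n C (k + 1).
A*n^k≤C-eventually : ∀ k A → Σ ℕ λ N → ∀ n → N ≤ n → A * n ^ k ≤ n C suc k
A*n^k≤C-eventually k A = K * suc B , bound
  where
    K = suc k
    B = A * (2 * K) ^ k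
    bound : ∀ n → K * suc B ≤ n → A * n ^ k ≤ n C K
    bound n N≤n = begin
      A * n ^ k                     ≤⟨ *-monoʳ-≤ A (^-monoˡ-≤ k n≤2Kt) ⟩
      A * (2 * K * t) ^ k           ≡⟨ cong (A *_) (^-distribʳ-* (2 * K) t k) ⟩
      A * ((2 * K) ^ k * t ^ k)     ≡⟨ *-assoc A ((2 * K) ^ k) (t ^ k) ⟨
      B * t ^ k                     ≤⟨ *-monoˡ-≤ (t ^ k) (<⇒≤ B<t) ⟩
      t ^ K                         ≤⟨ ^≤C K t ⟩
      (K * t) C K                   ≤⟨ C-monoˡ-≤ K (subst (_≤ n) (*-comm t K) (m/n*n≤m n K)) ⟩
      n C K                         ∎
      where
        open ≤-Reasoning
        t = n / K
        B<t : B < t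
        B<t = subst (_≤ t) (trans (cong (_/ K) (*-comm K (suc B))) (m*n/n≡m (suc B) K)) (/-monoˡ-≤ K N≤n)
        K≤Kt : K ≤ K * t
        K≤Kt = subst (_≤ K * t) (*-identityʳ K) (*-monoʳ-≤ K (≤-trans (s≤s z≤n) B<t))
        n≤2Kt : n ≤ 2 * K * t
        n≤2Kt = begin
          n                   ≡⟨ m≡m%n+[m/n]*n n K ⟩
          n % K + t * K       ≤⟨ +-monoˡ-≤ (t * K) (≤-trans (<⇒≤ (m%n<n n K)) K≤Kt) ⟩
          K * t + t * K       ≡⟨ cong (K * t +_) (*-comm t K) ⟩
          K * t + K * t       ≡⟨ cong (λ m → K * t + m) (+-identityʳ (K * t)) ⟨
          2 * (K * t)         ≡⟨ *-assoc 2 K t ⟨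
          2 * K * t           ∎

-- The hypothesis k ≤ s ∸ 2 only serves to rule out s < 2.
corollary2p1 : (k s : ℕ) → 2 ≤ k → k ≤ s ∸ 2 →
    (m : ℕ) → Σ ℕ λ N → (n : ℕ) → N ≤ n → (G : Graph n) → MinSaturated s k G →
    suc m * ((n C k) ∸ numIndep k G) ≤ n C k
corollary2p1 1             s             (s≤s ()) _ _
corollary2p1 (suc (suc j)) (suc (suc c)) _ _ m = suc N , bound
  where
    K = suc (suc j) * (3 + c)
    N = proj₁ (A*n^k≤C-eventually (suc j) (suc m * K))
    bound : ∀ n → suc N ≤ n → (G : Graph n) → MinSaturated (2 + c) (2 + j) G →
      suc m * (n C (2 + j) ∸ numIndep (2 + j) G) ≤ n C (2 + j)
    bound n N<n G G-min = begin
      suc m * (n C (2 + j) ∸ numIndep (2 + j) G)  ≤⟨ *-monoʳ-≤ (suc m) (C∸numIndep≤ j G) ⟩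
      suc m * (length (edges G) * n ^ j)          ≤⟨ *-monoʳ-≤ (suc m) (*-monoˡ-≤ (n ^ j) (minSaturated-edges≤ c (suc j) G 1≤n G-min)) ⟩
      suc m * (K * n * n ^ j)                     ≡⟨ cong (suc m *_) (*-assoc K n (n ^ j)) ⟩
      suc m * (K * n ^ suc j)                     ≡⟨ *-assoc (suc m) K (n ^ suc j) ⟨
      suc m * K * n ^ suc j                       ≤⟨ proj₂ (A*n^k≤C-eventually (suc j) (suc m * K)) n (<⇒≤ N<n) ⟩
      n C (2 + j)                                 ∎
      where
        open ≤-Reasoning
        1≤n = ≤-trans (s≤s z≤n) N<n
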